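{- Let $G$ be a graph of order $n$ with minimum degree $\delta$ and maximum degree $\Delta$, and let $k\in\{2-\Delta,\dots,\Delta\}$ be an integer. Then $$\gamma_k^o(G)\ge\left\lceil\frac{(k+\delta)n}{2\Delta+\delta+k}\right\rceil.$$
   Context: For a finite simple graph $G$ and $S\subseteq V(G)$ with $\overline{S}=V(G)\setminus S$, $S$ is a global offensive $k$-alliance of $G$ if $N[S]=V(G)$ and $|N(v)\cap S|\ge |N(v)\cap\overline{S}|+k$ for every $v\in\overline{S}$; $\gamma_k^o(G)$ is the minimum cardinality of such a set. -}

module Defs where

open import Data.Nat as ℕ using (ℕ; suc; _≤_)
open import Data.Integer as ℤ using (ℤ; +_; _+_; _*_; _-_)
open import Data.Fin using (Fin)
open import Data.Fin.Subset using (Subset; _∈_; _∉_; _∩_; ∁; ∣_∣)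
open import Data.Product using (Σ; ∃; _×_; _,_)
open import Data.Sum using (_⊎_)
open import Relation.Binary.PropositionalEquality using (_≡_)
open import Data.Rational using (ℚ; _/_; ceiling)

record Graph (n : ℕ) : Set where
  field
    N     : Fin n → Subset n
    sym   : ∀ u v → u ∈ N v → v ∈ N u
    irrefl : ∀ v → v ∉ N v
open Graph public

deg : ∀ {n} → Graph n → Fin n → ℕ
deg G v = ∣ N G v ∣

IsMinDegree : ∀ {n} → Graph n → ℕ → Set
IsMinDegree G δ = (∃ λ v → deg G v ≡ δ) × (∀ v → δ ≤ deg G v)

IsMaxDegree : ∀ {n} → Graph n → ℕ → Set
IsMaxDegree G Δ = (∃ λ v → deg G v ≡ Δ) × (∀ v → deg G v ≤ Δ)

Dominating : ∀ {n} → Graph n → Subset n → Set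
Dominating G S = ∀ v → v ∈ S ⊎ (∃ λ u → u ∈ S × u ∈ N G v)

IsGlobalOffensiveAlliance : ∀ {n} → ℤ → Graph n → Subset n → Set
IsGlobalOffensiveAlliance k G S =
  Dominating G S ×
  (∀ v → v ∈ ∁ S → + ∣ N G v ∩ ∁ S ∣ + k ℤ.≤ + ∣ N G v ∩ S ∣)

IsGammaO : ∀ {n} → ℤ → Graph n → ℕ → Set
IsGammaO k G γ =
  (∃ λ S → IsGlobalOffensiveAlliance k G S × ∣ S ∣ ≡ γ) ×
  (∀ S → IsGlobalOffensiveAlliance k G S → γ ≤ ∣ S ∣)

-- ⌈ a / b ⌉ for a positive integer b (junk value 0 when b ≤ 0; never used below)
ceilFrac : ℤ → ℤ → ℤ
ceilFrac a (+ suc m) = ceiling (a / suc m)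
ceilFrac a _ = + 0

-- For a vertex v outside a global offensive k-alliance S, δ ≤ deg v = |N(v) ∩ S| + |N(v) ∖ S| and
-- |N(v) ∖ S| + k ≤ |N(v) ∩ S| give δ + k ≤ 2 |N(v) ∩ S|. Summing over V ∖ S counts every edge
-- between S and V ∖ S twice; counted from the side of S there are at most Δ |S| of them. Hence
-- (n − |S|)(δ + k) ≤ 2Δ |S|, i.e. (δ + k) n ≤ |S| (2Δ + δ + k), and k ≥ 2 − Δ makes the
-- denominator 2Δ + δ + k positive, so the bound passes to the ceiling.
module Submission where

open import Defs hiding (sym)
open import Data.Nat as ℕ using (ℕ; suc)
open import Data.Nat.GCD using (gcd[m,n]≢0)
open import Data.Integer.GCD using (gcd)
import Data.Nat.Properties as ℕ
open import Data.Integer as ℤ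
  using (ℤ; +_; +[1+_]; +0; -[1+_]; _+_; _*_; _-_; -_; _≤_; _<_; +<+; +≤+; _/ℕ_)
open import Data.Integer.Properties
open import Data.Integer.DivMod using (n<s[n/ℕd]*d; div-pos-is-/ℕ)
open import Data.Integer.Tactic.RingSolver using (solve-∀)
open import Data.Rational as ℚ using (mkℚ; ↥_; ↧_; floor; ceiling)
import Data.Rational.Properties as ℚ
open import Algebra.Properties.Semiring.Sum +-*-semiring
  using (sum; ∑-comm; ∑-distrib-+; sum-cong-≗; *-distribˡ-sum)
open import Data.Bool using (Bool; true; false; _∧_)
open import Data.Bool.Properties using (∧-comm; ∧-assoc; ⇔→≡)
open import Data.Fin as Fin using (Fin)
open import Data.Vec using ([]; _∷_; lookup)
open import Data.Vec.Functional using (Vector)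
open import Data.Vec.Properties using (lookup-zipWith; []=⇒lookup; lookup⇒[]=)
open import Data.Fin.Subset using (Subset; _∈_; _∩_; ∁; ∣_∣)
open import Data.Fin.Subset.Properties using (∣p∣≤n; ∣∁p∣≡n∸∣p∣; ∣p∩q∣≤∣p∣)
open import Data.Product using (_×_; _,_)
open import Data.Sum using (inj₂)
open import Function.Bundles using (mk⇔)
open import Relation.Binary.PropositionalEquality
  using (_≡_; refl; sym; trans; cong; subst; subst₂; module ≡-Reasoning)

≤-/ℕ : ∀ {c} x d .{{_ : ℕ.NonZero d}} → c * + d ≤ x → c ≤ x /ℕ d
≤-/ℕ {c} x d cd≤x = subst (c ≤_) (pred-suc (x /ℕ d)) (i<j⇒i≤pred[j] c<1+x/d)
  where
  c<1+x/d : c < ℤ.suc (x /ℕ d)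
  c<1+x/d = *-cancelʳ-<-nonNeg (+ d) (≤-<-trans cd≤x (n<s[n/ℕd]*d x d))

floor-greatest : ∀ {c} p → c * ↧ p ≤ ↥ p → c ≤ floor p
floor-greatest {c} (mkℚ x d-1 _) h =
  subst (c ≤_) (sym (div-pos-is-/ℕ x (suc d-1))) (≤-/ℕ x (suc d-1) h)

ceiling-least : ∀ {c} p → ↥ p ≤ c * ↧ p → ceiling p ≤ c
ceiling-least {c} p@record{} h =
  subst (ceiling p ≤_) (neg-involutive c) (neg-mono-≤ (floor-greatest (ℚ.- p) h⁻))
  where
  h⁻ : - c * ↧ (ℚ.- p) ≤ ↥ (ℚ.- p)
  h⁻ = subst₂ _≤_ (trans (neg-distribˡ-* c (↧ p)) (cong (- c *_) (sym (ℚ.↧-neg p))))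
                  (sym (ℚ.↥-neg p)) (neg-mono-≤ h)

ceiling-/-least : ∀ {c} a m → a ≤ c * + suc m → ceiling (a ℚ./ suc m) ≤ c
ceiling-/-least {c} a m a≤cd = ceiling-least p (*-cancelʳ-≤-pos (↥ p) (c * ↧ p) g ↥g≤c↧g)
  where
  open ≤-Reasoning
  -- a / suc m is stored in lowest terms: numerator and denominator are a and suc m divided by g.
  p = a ℚ./ suc m
  g = gcd a (+ suc m)
  instance
    g-pos : ℤ.Positive g
    g-pos = ℤ.positive (+<+ (ℕ.n≢0⇒n>0 (gcd[m,n]≢0 ℤ.∣ a ∣ (suc m) (inj₂ λ ()))))
  ↥g≤c↧g : ↥ p * g ≤ c * ↧ p * g
  ↥g≤c↧g = begin
    ↥ p * g       ≡⟨ ℚ.↥-/ a (suc m) ⟩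
    a             ≤⟨ a≤cd ⟩
    c * + suc m   ≡⟨ cong (c *_) (ℚ.↧-/ a (suc m)) ⟨
    c * (↧ p * g) ≡⟨ *-assoc c (↧ p) g ⟨
    c * ↧ p * g   ∎

ceilFrac-least : ∀ {c} a d → + 0 < d → a ≤ c * d → ceilFrac a d ≤ c
ceilFrac-least a +[1+ m ] _ = ceiling-/-least a m
ceilFrac-least a +0       (+<+ ())
ceilFrac-least a -[1+ m ] ()

k+d≤a+a : ∀ {k d a b} → d ≤ a + b → b + k ≤ a → k + d ≤ a + a
k+d≤a+a {k} {d} {a} {b} d≤a+b b+k≤a = begin
  k + d         ≤⟨ +-monoʳ-≤ k d≤a+b ⟩
  k + (a + b)   ≡⟨ rearrange k a b ⟩
  (b + k) + a   ≤⟨ +-monoˡ-≤ a b+k≤a ⟩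
  a + a         ∎
  where
  open ≤-Reasoning
  rearrange : ∀ k a b → k + (a + b) ≡ (b + k) + a
  rearrange = solve-∀

∣p∣≡∣p∩q∣+∣p∩∁q∣ : ∀ {n} (p q : Subset n) → ∣ p ∣ ≡ ∣ p ∩ q ∣ ℕ.+ ∣ p ∩ ∁ q ∣
∣p∣≡∣p∩q∣+∣p∩∁q∣ []          []          = refl
∣p∣≡∣p∩q∣+∣p∩∁q∣ (false ∷ p) (_     ∷ q) = ∣p∣≡∣p∩q∣+∣p∩∁q∣ p q
∣p∣≡∣p∩q∣+∣p∩∁q∣ (true  ∷ p) (true  ∷ q) = cong suc (∣p∣≡∣p∩q∣+∣p∩∁q∣ p q)
∣p∣≡∣p∩q∣+∣p∩∁q∣ (true  ∷ p) (false ∷ q) =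
  trans (cong suc (∣p∣≡∣p∩q∣+∣p∩∁q∣ p q)) (sym (ℕ.+-suc _ _))

∣p∣+∣∁p∣≡n : ∀ {n} (p : Subset n) → ∣ p ∣ ℕ.+ ∣ ∁ p ∣ ≡ n
∣p∣+∣∁p∣≡n p = trans (cong (∣ p ∣ ℕ.+_) (∣∁p∣≡n∸∣p∣ p)) (ℕ.m+[n∸m]≡n (∣p∣≤n p))

sum-mono-≤ : ∀ {n} {f g : Vector ℤ n} → (∀ i → f i ≤ g i) → sum f ≤ sum g
sum-mono-≤ {ℕ.zero}  f≤g = ≤-refl
sum-mono-≤ {suc n} f≤g = +-mono-≤ (f≤g Fin.zero) (sum-mono-≤ (λ i → f≤g (Fin.suc i)))

𝟙 : Bool → ℤ
𝟙 true  = + 1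
𝟙 false = + 0

𝟙-∧ : ∀ a b → 𝟙 (a ∧ b) ≡ 𝟙 a * 𝟙 b
𝟙-∧ true  b = sym (*-identityˡ (𝟙 b))
𝟙-∧ false b = sym (*-zeroˡ (𝟙 b))

∣p∣≡∑𝟙 : ∀ {n} (p : Subset n) → + ∣ p ∣ ≡ sum (λ i → 𝟙 (lookup p i))
∣p∣≡∑𝟙 []          = refl
∣p∣≡∑𝟙 (true  ∷ p) = cong ℤ.suc (∣p∣≡∑𝟙 p)
∣p∣≡∑𝟙 (false ∷ p) = trans (∣p∣≡∑𝟙 p) (sym (+-identityˡ _))

𝟙*∣p∩q∣ : ∀ {n} a (p q : Subset n) →
          𝟙 a * + ∣ p ∩ q ∣ ≡ sum (λ i → 𝟙 (a ∧ lookup p i ∧ lookup q i))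
𝟙*∣p∩q∣ a p q = begin
  𝟙 a * + ∣ p ∩ q ∣                            ≡⟨ cong (𝟙 a *_) (∣p∣≡∑𝟙 (p ∩ q)) ⟩
  𝟙 a * sum (λ i → 𝟙 (p∩q i))                  ≡⟨ *-distribˡ-sum (𝟙 a) (λ i → 𝟙 (p∩q i)) ⟩
  sum (λ i → 𝟙 a * 𝟙 (p∩q i))                  ≡⟨ sum-cong-≗ (λ i → sym (𝟙-∧ a (p∩q i))) ⟩
  sum (λ i → 𝟙 (a ∧ p∩q i))                    ≡⟨ sum-cong-≗ (λ i → cong (λ b → 𝟙 (a ∧ b)) (lookup-zipWith _∧_ i p q)) ⟩
  sum (λ i → 𝟙 (a ∧ lookup p i ∧ lookup q i))  ∎
  where
  open ≡-Reasoning
  p∩q : Fin _ → Bool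
  p∩q i = lookup (p ∩ q) i

sumOver : ∀ {n} → Subset n → Vector ℤ n → ℤ
sumOver P f = sum (λ i → 𝟙 (lookup P i) * f i)

sumOver-const : ∀ {n} (P : Subset n) c → sumOver P (λ _ → c) ≡ c * + ∣ P ∣
sumOver-const P c = begin
  sum (λ i → 𝟙 (lookup P i) * c) ≡⟨ sum-cong-≗ (λ i → *-comm (𝟙 (lookup P i)) c) ⟩
  sum (λ i → c * 𝟙 (lookup P i)) ≡⟨ *-distribˡ-sum c (λ i → 𝟙 (lookup P i)) ⟨
  c * sum (λ i → 𝟙 (lookup P i)) ≡⟨ cong (c *_) (∣p∣≡∑𝟙 P) ⟨
  c * + ∣ P ∣                    ∎
  where open ≡-Reasoning

sumOver-+ : ∀ {n} (P : Subset n) (f g : Vector ℤ n) →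
            sumOver P (λ i → f i + g i) ≡ sumOver P f + sumOver P g
sumOver-+ P f g = trans (sum-cong-≗ (λ i → *-distribˡ-+ (𝟙 (lookup P i)) (f i) (g i)))
                        (∑-distrib-+ (λ i → 𝟙 (lookup P i) * f i) (λ i → 𝟙 (lookup P i) * g i))

sumOver-mono-≤ : ∀ {n} (P : Subset n) {f g : Vector ℤ n} →
                 (∀ i → i ∈ P → f i ≤ g i) → sumOver P f ≤ sumOver P g
sumOver-mono-≤ P {f} {g} f≤g = sum-mono-≤ term-≤
  where
  term-≤ : ∀ i → 𝟙 (lookup P i) * f i ≤ 𝟙 (lookup P i) * g i
  term-≤ i with lookup P i in i∈P
  ... | true  = *-monoˡ-≤-nonNeg (+ 1) (f≤g i (lookup⇒[]= i P i∈P))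
  ... | false = ≤-refl

∧-reverse : ∀ a b c → a ∧ b ∧ c ≡ c ∧ b ∧ a
∧-reverse a b c = trans (∧-comm a (b ∧ c)) (trans (cong (_∧ a) (∧-comm b c)) (∧-assoc c b a))

module _ {n} (G : Graph n) where

  adjacent-sym : ∀ u v → lookup (N G u) v ≡ lookup (N G v) u
  adjacent-sym u v = ⇔→≡ (mk⇔ (flip-adjacency u v) (flip-adjacency v u))
    where
    flip-adjacency : ∀ u v → lookup (N G u) v ≡ true → lookup (N G v) u ≡ true
    flip-adjacency u v v∈Nu = []=⇒lookup (Graph.sym G v u (lookup⇒[]= v (N G u) v∈Nu))

  handshake : ∀ (P Q : Subset n) →
              sumOver P (λ v → + ∣ N G v ∩ Q ∣) ≡ sumOver Q (λ v → + ∣ N G v ∩ P ∣)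
  handshake P Q = begin
    sumOver P (λ v → + ∣ N G v ∩ Q ∣)
      ≡⟨ sum-cong-≗ (λ v → 𝟙*∣p∩q∣ (lookup P v) (N G v) Q) ⟩
    sum (λ v → sum (λ u → 𝟙 (lookup P v ∧ lookup (N G v) u ∧ lookup Q u)))
      ≡⟨ ∑-comm (λ v u → 𝟙 (lookup P v ∧ lookup (N G v) u ∧ lookup Q u)) ⟩
    sum (λ u → sum (λ v → 𝟙 (lookup P v ∧ lookup (N G v) u ∧ lookup Q u)))
      ≡⟨ sum-cong-≗ (λ u → sum-cong-≗ (λ v → cong 𝟙 (edge-reverse u v))) ⟩
    sum (λ u → sum (λ v → 𝟙 (lookup Q u ∧ lookup (N G u) v ∧ lookup P v)))
      ≡⟨ sum-cong-≗ (λ u → 𝟙*∣p∩q∣ (lookup Q u) (N G u) P) ⟨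
    sumOver Q (λ v → + ∣ N G v ∩ P ∣) ∎
    where
    open ≡-Reasoning
    edge-reverse : ∀ u v → lookup P v ∧ lookup (N G v) u ∧ lookup Q u
                         ≡ lookup Q u ∧ lookup (N G u) v ∧ lookup P v
    edge-reverse u v = trans (∧-reverse (lookup P v) _ (lookup Q u))
                             (cong (λ b → lookup Q u ∧ b ∧ lookup P v) (adjacent-sym v u))

  globalOffensiveAlliance-bound :
    ∀ {δ Δ k S} → (∀ v → δ ℕ.≤ deg G v) → (∀ v → deg G v ℕ.≤ Δ) →
    IsGlobalOffensiveAlliance k G S → (k + + δ) * + n ≤ + ∣ S ∣ * (+ 2 * + Δ + + δ + k)
  globalOffensiveAlliance-bound {δ} {Δ} {k} {S} δ≤deg deg≤Δ (_ , offensive) = begin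
    c * + n                       ≡⟨ cong (c *_) n≡s+s̄ ⟩
    c * (s + s̄)                   ≡⟨ *-distribˡ-+ c s s̄ ⟩
    c * s + c * s̄                 ≤⟨ +-monoʳ-≤ (c * s) outside-≤ ⟩
    c * s + (+ Δ * s + + Δ * s)   ≡⟨ rearrange k (+ δ) (+ Δ) s ⟩
    s * (+ 2 * + Δ + + δ + k)     ∎
    where
    open ≤-Reasoning
    c s s̄ : ℤ
    c = k + + δ
    s = + ∣ S ∣
    s̄ = + ∣ ∁ S ∣
    dS dS̄ : Fin n → ℤ
    dS v = + ∣ N G v ∩ S ∣
    dS̄ v = + ∣ N G v ∩ ∁ S ∣

    n≡s+s̄ : + n ≡ s + s̄
    n≡s+s̄ = trans (cong +_ (sym (∣p∣+∣∁p∣≡n S))) (pos-+ ∣ S ∣ ∣ ∁ S ∣)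

    rearrange : ∀ k d D s → (k + d) * s + (D * s + D * s) ≡ s * (+ 2 * D + d + k)
    rearrange = solve-∀

    outside-vertex-≤ : ∀ v → v ∈ ∁ S → c ≤ dS v + dS v
    outside-vertex-≤ v v∉S =
      k+d≤a+a {k} {b = dS̄ v} (subst (+ δ ≤_) deg-split (+≤+ (δ≤deg v))) (offensive v v∉S)
      where
      deg-split : + deg G v ≡ dS v + dS̄ v
      deg-split = trans (cong +_ (∣p∣≡∣p∩q∣+∣p∩∁q∣ (N G v) S))
                        (pos-+ ∣ N G v ∩ S ∣ ∣ N G v ∩ ∁ S ∣)

    dS̄≤Δ : ∀ u → dS̄ u ≤ + Δ
    dS̄≤Δ u = +≤+ (ℕ.≤-trans (∣p∩q∣≤∣p∣ (N G u) (∁ S)) (deg≤Δ u))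

    crossing-≤ : sumOver (∁ S) dS ≤ + Δ * s
    crossing-≤ = begin
      sumOver (∁ S) dS        ≡⟨ handshake (∁ S) S ⟩
      sumOver S dS̄            ≤⟨ sumOver-mono-≤ S (λ u _ → dS̄≤Δ u) ⟩
      sumOver S (λ _ → + Δ)    ≡⟨ sumOver-const S (+ Δ) ⟩
      + Δ * s                  ∎

    outside-≤ : c * s̄ ≤ + Δ * s + + Δ * s
    outside-≤ = begin
      c * s̄                                     ≡⟨ sumOver-const (∁ S) c ⟨
      sumOver (∁ S) (λ _ → c)                   ≤⟨ sumOver-mono-≤ (∁ S) outside-vertex-≤ ⟩
      sumOver (∁ S) (λ v → dS v + dS v)       ≡⟨ sumOver-+ (∁ S) dS dS ⟩
      sumOver (∁ S) dS + sumOver (∁ S) dS     ≤⟨ +-mono-≤ crossing-≤ crossing-≤ ⟩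
      + Δ * s + + Δ * s                         ∎

corollary1 : ∀ {n} (G : Graph n) (δ Δ : ℕ) (k : ℤ) (γ : ℕ) →
    IsMinDegree G δ → IsMaxDegree G Δ →
    (+ 2 - + Δ ≤ k) × (k ≤ + Δ) →
    IsGammaO k G γ →
    ceilFrac ((k + + δ) * + n) (+ 2 * + Δ + + δ + k) ≤ + γ
corollary1 {n} G δ Δ k γ (_ , δ≤deg) (_ , deg≤Δ) (2-Δ≤k , _) ((S , alliance , ∣S∣≡γ) , _) =
  ceilFrac-least _ _ denominator-pos
    (subst (λ m → (k + + δ) * + n ≤ + m * (+ 2 * + Δ + + δ + k)) ∣S∣≡γ
           (globalOffensiveAlliance-bound G δ≤deg deg≤Δ alliance))
  where
  open ≤-Reasoning
  rearrange : ∀ D d → + 2 + (D + d) ≡ + 2 * D + d + (+ 2 - D)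
  rearrange = solve-∀
  denominator-pos : + 0 < + 2 * + Δ + + δ + k
  denominator-pos = begin-strict
    + 0                              <⟨ +<+ ℕ.z<s ⟩
    + 2 + (+ Δ + + δ)                ≡⟨ rearrange (+ Δ) (+ δ) ⟩
    + 2 * + Δ + + δ + (+ 2 - + Δ)    ≤⟨ +-monoʳ-≤ (+ 2 * + Δ + + δ) 2-Δ≤k ⟩
    + 2 * + Δ + + δ + k              ∎
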